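{- Let $\mathcal X = \mathbb F_2^3 = \mathbb F_2\times\mathbb F_2\times\mathbb F_2$ (three players, each with question set $\mathbb F_2$) and let $Q = \{(x,y,z)\in\mathbb F_2^3 : x+y+z=0\}$. Then for every $n\in\mathbb N$, $E_Q(n) = r_{\square}(\mathbb F_2^n)$.
   Context: For $Q\subseteq\mathcal X = \mathcal X^{(1)}\times\dots\times\mathcal X^{(k)}$ with $q=|Q|$ and $n\in\mathbb N$: for $x\in Q^n\subseteq \mathcal X^n$ write $x_i\in\mathcal X$ for its $i$-th coordinate tuple, $x^{(j)}\in(\mathcal X^{(j)})^n$ for the vector of $j$-th entries, and $x^{(j)}_i$ for the $j$-th entry of $x_i$. A set $W\subseteq Q^n$ contains a forbidden subgraph if there are $e(1),\dots,e(q)\in W$ and $i\in[n]$ such that (1) $\{e(1)_i,\dots,e(q)_i\}=Q$ and (2) for every $j\in[k]$ and $r,r'\in[q]$, $e(r)^{(j)}_i=e(r')^{(j)}_i$ implies $e(r)^{(j)}=e(r')^{(j)}$. $E_Q(n)$ is the maximum of $|W|/q^n$ over all $W\subseteq Q^n$ containing no forbidden subgraph. A square in $\mathbb F_2^n\times\mathbb F_2^n$ is a set $\{(x,y),(x+d,y),(x,y+d),(x+d,y+d)\}$ with $x,y,d\in\mathbb F_2^n$, $d\ne0$. $r_{\square}(\mathbb F_2^n)$ is the maximum of $|A|/4^n$ over sets $A\subseteq\mathbb F_2^n\times\mathbb F_2^n$ containing no square. -}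

module Defs where

open import Data.Bool using (Bool; true; false; _xor_)
open import Data.Nat using (ℕ; _^_; NonZero)
open import Data.Nat.Properties using (m^n≢0)
open import Data.Integer using (+_)
open import Data.Rational using (ℚ; _/_; _≤_)
open import Data.Fin using (Fin; zero; suc)
open import Data.Vec using (Vec; lookup; map; zipWith; replicate)
open import Data.List using (List; []; _∷_; length)
open import Data.List.Membership.Propositional using (_∈_)
open import Data.List.Relation.Unary.All using (All)
open import Data.List.Relation.Unary.Unique.Propositional using (Unique)
open import Data.Product using (_×_; _,_; Σ; ∃; ∃-syntax)
open import Function.Bundles using (_⇔_)
open import Relation.Binary.PropositionalEquality using (_≡_; _≢_)
open import Relation.Nullary using (¬_)

-- 𝔽₂ is modelled by Bool, with addition _xor_ and zero false.
F2 : Set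
F2 = Bool

Pt : Set
Pt = F2 × F2 × F2

coord : Fin 3 → Pt → F2
coord zero (a , b , c) = a
coord (suc zero) (a , b , c) = b
coord (suc (suc zero)) (a , b , c) = c

col : ∀ {n} → Fin 3 → Vec Pt n → Vec F2 n
col j x = map (coord j) x

IsSubsetOfQn : (Q : List Pt) (n : ℕ) → List (Vec Pt n) → Set
IsSubsetOfQn Q n W = Unique W × All (All′) W
  where
  All′ : Vec Pt n → Set
  All′ x = ∀ i → lookup x i ∈ Q

ContainsForbidden : (Q : List Pt) (n : ℕ) → List (Vec Pt n) → Set
ContainsForbidden Q n W =
  Σ (Fin (length Q) → Vec Pt n) λ e → Σ (Fin n) λ i →
    (∀ r → e r ∈ W)
    × (∀ p → (p ∈ Q) ⇔ (∃[ r ] lookup (e r) i ≡ p))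
    × (∀ (j : Fin 3) (r r′ : Fin (length Q)) →
         coord j (lookup (e r) i) ≡ coord j (lookup (e r′) i) →
         col j (e r) ≡ col j (e r′))

IsMaxOf : {A : Set} → (A → Set) → (A → ℚ) → ℚ → Set
IsMaxOf {A} P f v = (Σ A λ a → P a × f a ≡ v) × (∀ a → P a → f a ≤ v)

IsE : (Q : List Pt) .{{_ : NonZero (length Q)}} (n : ℕ) → ℚ → Set
IsE Q n = IsMaxOf (λ W → IsSubsetOfQn Q n W × ¬ ContainsForbidden Q n W)
                  (λ W → _/_ (+ length W) (length Q ^ n)
                            {{m^n≢0 (length Q) n}})

_⊕_ : ∀ {n} → Vec F2 n → Vec F2 n → Vec F2 n
_⊕_ = zipWith _xor_

0v : ∀ {n} → Vec F2 n
0v = replicate _ false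

ContainsSquare : (n : ℕ) → List (Vec F2 n × Vec F2 n) → Set
ContainsSquare n A =
  Σ (Vec F2 n) λ x → Σ (Vec F2 n) λ y → Σ (Vec F2 n) λ d →
    d ≢ 0v
    × ((x , y) ∈ A) × ((x ⊕ d , y) ∈ A)
    × ((x , y ⊕ d) ∈ A) × ((x ⊕ d , y ⊕ d) ∈ A)

IsRSquare : (n : ℕ) → ℚ → Set
IsRSquare n = IsMaxOf (λ A → Unique A × ¬ ContainsSquare n A)
                      (λ A → _/_ (+ length A) (4 ^ n) {{m^n≢0 4 n}})

Q₀ : List Pt
Q₀ = (false , false , false) ∷ (false , true , true)
   ∷ (true , false , true) ∷ (true , true , false) ∷ []

{-# OPTIONS --safe #-}
-- Q is the graph of addition on 𝔽₂, so a word of Qⁿ is a pair (x, y) ∈ 𝔽₂ⁿ × 𝔽₂ⁿ whose three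
-- columns are x, y and x + y.  A forbidden subgraph at coordinate i consists of four pairs whose
-- i-th entries run through Q; the column condition makes them a rectangle (x, y), (x, u), (x′, y),
-- (x′, u) with x + u = x′ + y, i.e. a square with d = x + x′ = y + u ≠ 0.  Conversely a square with
-- dᵢ = 1, translated by d so that its base corner has i-th entries (0, 0), is a forbidden subgraph.
-- So the two kinds of extremal sets correspond with equal sizes, and |Q|ⁿ = 4ⁿ; the maximum exists
-- because only finitely many square-free sets have to be compared.
module Submission where

open import Defs
open import Algebra.Bundles using (AbelianGroup)
open import Algebra.Structures using (IsAbelianGroup)
import Algebra.Properties.AbelianGroup as AbelianGroupProperties
import Algebra.Properties.CommutativeSemigroup as CommutativeSemigroupProperties
open import Data.Bool using (true; false; _xor_)
import Data.Bool as Bool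
open import Data.Bool.Properties using (xor-assoc; xor-comm; xor-identityˡ; xor-identityʳ; xor-same)
open import Data.Empty using (⊥-elim)
open import Data.Fin using (Fin; zero; suc)
open import Data.Fin.Subset.Properties using (anySubset?)
open import Data.Integer using (+_; +≤+)
import Data.Integer.Properties as ℤ
open import Data.List using (List; []; _∷_; [_]; length; map; _++_; filter; cartesianProductWith)
import Data.List as List
open import Data.List.Extrema.Nat using (argmax; argmax-all; f[xs]≤f[argmax])
open import Data.List.Membership.Propositional using (_∈_)
open import Data.List.Membership.Propositional.Properties
  using (∈-++⁺ˡ; ∈-++⁺ʳ; ∈-map⁺; ∈-map⁻; ∈-filter⁺; ∈-filter⁻; ∈-lookup;
         ∈-cartesianProduct⁺; ∈-cartesianProductWith⁺)
open import Data.List.Membership.Propositional.Properties.WithK using (unique∧set⇒bag)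
import Data.List.Membership.DecPropositional as DecMembership
open import Data.List.Properties using (length-map; map-∘; map-id-local)
open import Data.List.Relation.Binary.BagAndSetEquality using (_∼[_]_; set; ∼bag⇒↭)
open import Data.List.Relation.Binary.Permutation.Propositional.Properties using (↭-length)
open import Data.List.Relation.Binary.Sublist.Propositional as Sublist using ([]; _∷_; _∷ʳ_)
open import Data.List.Relation.Binary.Sublist.Propositional.Properties using (filter-⊆)
open import Data.List.Relation.Binary.Subset.Propositional using (_⊆_)
open import Data.List.Relation.Unary.All as All using (All)
open import Data.List.Relation.Unary.All.Properties using (all-filter) renaming (map⁺ to All-map⁺)
open import Data.List.Relation.Unary.AllPairs using ([]; _∷_)
open import Data.List.Relation.Unary.Any using (here; there; index)
open import Data.List.Relation.Unary.Any.Properties using (lookup-index)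
open import Data.List.Relation.Unary.Unique.Propositional using (Unique)
import Data.List.Relation.Unary.Unique.Propositional.Properties as Unique
open import Data.List.Relation.Unary.Unique.DecPropositional using (unique?)
open import Data.Nat using (ℕ; suc; _≤_; _^_; NonZero)
open import Data.Nat.Properties using (m^n≢0; module ≤-Reasoning)
open import Data.Product using (_×_; ∃-syntax; _,_; proj₁; proj₂)
import Data.Product.Properties as Product
open import Data.Rational using (ℚ)
import Data.Rational as ℚ
open import Data.Rational.Properties using (toℚᵘ-cancel-≤; toℚᵘ-fromℚᵘ)
open import Data.Rational.Unnormalised as ℚᵘ using (ℚᵘ; mkℚᵘ; *≤*)
import Data.Rational.Unnormalised.Properties as ℚᵘ
open import Data.Vec using (Vec; []; _∷_; lookup; zipWith)
import Data.Vec.Properties as Vec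
open import Function.Base using (id; _∘_)
open import Function.Bundles using (_⇔_; mk⇔; Equivalence)
open import Level using (Level; 0ℓ)
open import Relation.Binary.Definitions using (DecidableEquality)
open import Relation.Binary.PropositionalEquality
  using (_≡_; _≢_; refl; sym; trans; cong; cong₂; subst; subst₂; module ≡-Reasoning)
open import Relation.Binary.PropositionalEquality.Algebra using (isMagma)
open import Relation.Nullary using (¬_; Dec; ¬?)
open import Relation.Nullary.Decidable using (_×-dec_)
open import Relation.Unary using (Pred; Decidable)

private
  variable
    ℓ₁ ℓ : Level
    X : Set ℓ₁
    n : ℕ

sublists : List X → List (List X)
sublists []       = [ [] ]
sublists (x ∷ xs) = map (x ∷_) (sublists xs) ++ sublists xs

⊆⇒∈sublists : ∀ {xs ys : List X} → xs Sublist.⊆ ys → xs ∈ sublists ys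
⊆⇒∈sublists []         = here refl
⊆⇒∈sublists (y ∷ʳ p)   = ∈-++⁺ʳ _ (⊆⇒∈sublists p)
⊆⇒∈sublists (refl ∷ p) = ∈-++⁺ˡ (∈-map⁺ (_ ∷_) (⊆⇒∈sublists p))

unique∧set⇒length≡ : ∀ {xs ys : List X} → Unique xs → Unique ys → xs ∼[ set ] ys →
                     length xs ≡ length ys
unique∧set⇒length≡ xs! ys! xs≈ys = ↭-length (∼bag⇒↭ (unique∧set⇒bag xs! ys! xs≈ys))

largest : DecidableEquality X → {U : List X} → Unique U → (∀ x → x ∈ U) →
          {P : Pred (List X) ℓ} → Decidable P → P [] → (∀ {xs ys} → xs ⊆ ys → P ys → P xs) →
          ∃[ M ] ((Unique M × P M) × (∀ xs → Unique xs × P xs → length xs ≤ length M))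
largest _≟_ {U} U! U-complete {P} P? P[] P-antitone =
  M , argmax-all length ([] , P[]) (all-filter admissible? (sublists U)) , bound
  where
  open DecMembership _≟_ using (_∈?_)

  admissible? : Decidable (λ xs → Unique xs × P xs)
  admissible? xs = unique? _≟_ xs ×-dec P? xs

  candidates = filter admissible? (sublists U)
  M = argmax length [] candidates

  -- xs has the same elements, hence the same length, as the candidate filter (_∈? xs) U.
  bound : ∀ xs → Unique xs × P xs → length xs ≤ length M
  bound xs (xs! , Pxs) = begin
    length xs  ≡⟨ unique∧set⇒length≡ xs! xs′! (mk⇔ (∈-filter⁺ (_∈? xs) (U-complete _)) xs′⊆xs) ⟩
    length xs′ ≤⟨ All.lookup (f[xs]≤f[argmax] {f = length} [] candidates) xs′∈candidates ⟩
    length M   ∎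
    where
    open ≤-Reasoning
    xs′ = filter (_∈? xs) U
    xs′⊆xs : xs′ ⊆ xs
    xs′⊆xs = proj₂ ∘ ∈-filter⁻ (_∈? xs) {xs = U}
    xs′! : Unique xs′
    xs′! = Unique.filter⁺ (_∈? xs) {U} U!
    xs′∈candidates : xs′ ∈ candidates
    xs′∈candidates =
      ∈-filter⁺ admissible? (⊆⇒∈sublists (filter-⊆ (_∈? xs) U)) (xs′! , P-antitone xs′⊆xs Pxs)

IsMaxOf-transfer : ∀ {X Y : Set} {P : X → Set} {Q : Y → Set} {f : X → ℚ} {g : Y → ℚ} {v : ℚ} →
                   (to : X → Y) → (∀ {x} → P x → Q (to x) × g (to x) ≡ f x) →
                   (from : Y → X) → (∀ {y} → Q y → P (from y) × f (from y) ≡ g y) →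
                   IsMaxOf P f v → IsMaxOf Q g v
IsMaxOf-transfer {v = v} to to-ok from from-ok ((x , Px , fx≡v) , max) =
  (to x , proj₁ (to-ok Px) , trans (proj₂ (to-ok Px)) fx≡v) ,
  λ y Qy → subst (ℚ._≤ v) (proj₂ (from-ok Qy)) (max (from y) (proj₁ (from-ok Qy)))

fromℚᵘ-mono-≤ : ∀ {p q : ℚᵘ} → p ℚᵘ.≤ q → ℚ.fromℚᵘ p ℚ.≤ ℚ.fromℚᵘ q
fromℚᵘ-mono-≤ {p} {q} p≤q = toℚᵘ-cancel-≤
  (ℚᵘ.≤-respʳ-≃ (ℚᵘ.≃-sym (toℚᵘ-fromℚᵘ q)) (ℚᵘ.≤-respˡ-≃ (ℚᵘ.≃-sym (toℚᵘ-fromℚᵘ p)) p≤q))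

-- (+ a) / suc d computes to fromℚᵘ (mkℚᵘ (+ a) d): mkℚᵘ stores the denominator minus one.
/-monoˡ-≤ : ∀ {a b} d .{{_ : NonZero d}} → a ≤ b → (+ a) ℚ./ d ℚ.≤ (+ b) ℚ./ d
/-monoˡ-≤ {a} {b} (suc d) a≤b =
  fromℚᵘ-mono-≤ {mkℚᵘ (+ a) d} {mkℚᵘ (+ b) d} (*≤* (ℤ.*-monoʳ-≤-nonNeg (+ suc d) (+≤+ a≤b)))

largest⇒IsMaxOf : ∀ {X : Set} {P : X → Set} (h : X → ℕ) d .{{_ : NonZero d}} {m : X} →
                  P m → (∀ x → P x → h x ≤ h m) → IsMaxOf P (λ x → (+ h x) ℚ./ d) ((+ h m) ℚ./ d)
largest⇒IsMaxOf h d {m} Pm max = (m , Pm , refl) , λ x Px → /-monoˡ-≤ d (max x Px)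

⊕-isAbelianGroup : ∀ n → IsAbelianGroup _≡_ (_⊕_ {n}) 0v id
⊕-isAbelianGroup n = record
  { isGroup = record
    { isMonoid = record
      { isSemigroup = record { isMagma = isMagma _⊕_ ; assoc = Vec.zipWith-assoc xor-assoc }
      ; identity    = Vec.zipWith-identityˡ xor-identityˡ , Vec.zipWith-identityʳ xor-identityʳ
      }
    ; inverse = ⊕-self , ⊕-self
    ; ⁻¹-cong = cong id
    }
  ; comm = Vec.zipWith-comm xor-comm
  }
  where
  ⊕-self : ∀ x → x ⊕ x ≡ 0v
  ⊕-self x = trans (cong (_⊕ x) (sym (Vec.map-id x))) (Vec.zipWith-inverseˡ xor-same x)

⊕-abelianGroup : ℕ → AbelianGroup 0ℓ 0ℓ
⊕-abelianGroup n = record { isAbelianGroup = ⊕-isAbelianGroup n }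

infixl 6 _⊕[_]_

_⊕[_]_ : Vec F2 n → F2 → Vec F2 n → Vec F2 n
x ⊕[ false ] d = x
x ⊕[ true  ] d = x ⊕ d

module _ {n : ℕ} where
  open AbelianGroup (⊕-abelianGroup n) using (assoc; inverseˡ; identityʳ; commutativeSemigroup)
  open AbelianGroupProperties (⊕-abelianGroup n)
    using (\\-leftDividesʳ; //-rightDividesʳ; x∙y⁻¹≈ε⇒x≈y)
  open CommutativeSemigroupProperties commutativeSemigroup using (interchange; xy∙z≈xz∙y; x∙yz≈y∙zx)

  ⊕-cancelˡ : ∀ (x y : Vec F2 n) → x ⊕ (x ⊕ y) ≡ y
  ⊕-cancelˡ = \\-leftDividesʳ

  ⊕-cancelʳ : ∀ (x y : Vec F2 n) → (x ⊕ y) ⊕ y ≡ x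
  ⊕-cancelʳ x y = //-rightDividesʳ y x

  ⊕≡0v⇒≡ : ∀ (x y : Vec F2 n) → x ⊕ y ≡ 0v → x ≡ y
  ⊕≡0v⇒≡ = x∙y⁻¹≈ε⇒x≈y

  ⊕-swap : ∀ {x x′ y u : Vec F2 n} → x ⊕ u ≡ x′ ⊕ y → y ⊕ (x ⊕ x′) ≡ u
  ⊕-swap {x} {x′} {y} {u} x⊕u≡x′⊕y = begin
    y ⊕ (x ⊕ x′) ≡⟨ x∙yz≈y∙zx y x x′ ⟩
    x ⊕ (x′ ⊕ y) ≡⟨ cong (x ⊕_) x⊕u≡x′⊕y ⟨
    x ⊕ (x ⊕ u)  ≡⟨ ⊕-cancelˡ x u ⟩
    u            ∎
    where open ≡-Reasoning

  ⊕[]-⊕[] : ∀ (x d : Vec F2 n) a b → x ⊕[ a ] d ⊕[ b ] d ≡ x ⊕[ a xor b ] d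
  ⊕[]-⊕[] x d false b     = refl
  ⊕[]-⊕[] x d true  false = refl
  ⊕[]-⊕[] x d true  true  = ⊕-cancelʳ x d

  ⊕[]-interchange : ∀ (x y d : Vec F2 n) a b → (x ⊕[ a ] d) ⊕ (y ⊕[ b ] d) ≡ (x ⊕ y) ⊕[ a xor b ] d
  ⊕[]-interchange x y d false false = refl
  ⊕[]-interchange x y d false true  = sym (assoc x y d)
  ⊕[]-interchange x y d true  false = xy∙z≈xz∙y x d y
  ⊕[]-interchange x y d true  true  = begin
    (x ⊕ d) ⊕ (y ⊕ d) ≡⟨ interchange x d y d ⟩
    (x ⊕ y) ⊕ (d ⊕ d) ≡⟨ cong ((x ⊕ y) ⊕_) (inverseˡ d) ⟩
    (x ⊕ y) ⊕ 0v      ≡⟨ identityʳ (x ⊕ y) ⟩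
    x ⊕ y             ∎
    where open ≡-Reasoning

  lookup-⊕[] : ∀ (x d : Vec F2 n) a {i} → lookup d i ≡ true →
               lookup (x ⊕[ a ] d) i ≡ lookup x i xor a
  lookup-⊕[] x d false     _    = sym (xor-identityʳ _)
  lookup-⊕[] x d true  {i} dᵢ≡1 =
    trans (Vec.lookup-zipWith _xor_ i x d) (cong (lookup x i xor_) dᵢ≡1)

≢0v⇒∃true : ∀ (d : Vec F2 n) → d ≢ 0v → ∃[ i ] lookup d i ≡ true
≢0v⇒∃true []          d≢0 = ⊥-elim (d≢0 refl)
≢0v⇒∃true (true  ∷ d) _   = zero , refl
≢0v⇒∃true (false ∷ d) d≢0 with ≢0v⇒∃true d (d≢0 ∘ cong (false ∷_))
... | i , dᵢ≡1 = suc i , dᵢ≡1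

bits : List F2
bits = false ∷ true ∷ []

vectors : ∀ n → List (Vec F2 n)
vectors 0       = [ [] ]
vectors (suc n) = cartesianProductWith _∷_ bits (vectors n)

∈-vectors : ∀ (x : Vec F2 n) → x ∈ vectors n
∈-vectors []          = here refl
∈-vectors (false ∷ x) = ∈-cartesianProductWith⁺ _∷_ {xs = bits} (here refl) (∈-vectors x)
∈-vectors (true  ∷ x) = ∈-cartesianProductWith⁺ _∷_ {xs = bits} (there (here refl)) (∈-vectors x)

vectors-unique : ∀ n → Unique (vectors n)
vectors-unique 0       = All.[] ∷ []
vectors-unique (suc n) =
  Unique.cartesianProductWith⁺ _∷_ Vec.∷-injective bits-unique (vectors-unique n)
  where
  bits-unique : Unique bits
  bits-unique = ((λ ()) All.∷ All.[]) ∷ All.[] ∷ []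

-- Words over Q₀ as pairs of vectors

Pair : ℕ → Set
Pair n = Vec F2 n × Vec F2 n

toQ : F2 → F2 → Pt
toQ a b = a , b , a xor b

toQ∈Q₀ : ∀ a b → toQ a b ∈ Q₀
toQ∈Q₀ false false = here refl
toQ∈Q₀ false true  = there (here refl)
toQ∈Q₀ true  false = there (there (here refl))
toQ∈Q₀ true  true  = there (there (there (here refl)))

toQ-coord : ∀ {p} → p ∈ Q₀ → toQ (coord zero p) (coord (suc zero) p) ≡ p
toQ-coord (here refl)                         = refl
toQ-coord (there (here refl))                 = refl
toQ-coord (there (there (here refl)))         = refl
toQ-coord (there (there (there (here refl)))) = refl

line : Fin 3 → Pair n → Vec F2 n
line zero             (x , y) = x
line (suc zero)       (x , y) = y
line (suc (suc zero)) (x , y) = x ⊕ y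

toWord : Pair n → Vec Pt n
toWord (x , y) = zipWith toQ x y

fromWord : Vec Pt n → Pair n
fromWord w = col zero w , col (suc zero) w

IsQWord : Vec Pt n → Set
IsQWord w = ∀ i → lookup w i ∈ Q₀

lookup-toWord : ∀ (x y : Vec F2 n) i → lookup (toWord (x , y)) i ≡ toQ (lookup x i) (lookup y i)
lookup-toWord x y i = Vec.lookup-zipWith toQ i x y

col-toWord : ∀ j (x y : Vec F2 n) → col j (toWord (x , y)) ≡ line j (x , y)
col-toWord zero             []      []      = refl
col-toWord zero             (a ∷ x) (b ∷ y) = cong (a ∷_) (col-toWord zero x y)
col-toWord (suc zero)       []      []      = refl
col-toWord (suc zero)       (a ∷ x) (b ∷ y) = cong (b ∷_) (col-toWord (suc zero) x y)
col-toWord (suc (suc zero)) []      []      = refl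
col-toWord (suc (suc zero)) (a ∷ x) (b ∷ y) = cong ((a xor b) ∷_) (col-toWord (suc (suc zero)) x y)

fromWord-toWord : ∀ (p : Pair n) → fromWord (toWord p) ≡ p
fromWord-toWord (x , y) = cong₂ _,_ (col-toWord zero x y) (col-toWord (suc zero) x y)

toWord-injective : ∀ {p q : Pair n} → toWord p ≡ toWord q → p ≡ q
toWord-injective {p = p} {q} eq = begin
  p                   ≡⟨ fromWord-toWord p ⟨
  fromWord (toWord p) ≡⟨ cong fromWord eq ⟩
  fromWord (toWord q) ≡⟨ fromWord-toWord q ⟩
  q                   ∎
  where open ≡-Reasoning

toWord-isQWord : ∀ (p : Pair n) → IsQWord (toWord p)
toWord-isQWord (x , y) i = subst (_∈ Q₀) (sym (lookup-toWord x y i)) (toQ∈Q₀ _ _)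

toWord-fromWord : ∀ (w : Vec Pt n) → IsQWord w → toWord (fromWord w) ≡ w
toWord-fromWord []      _  = refl
toWord-fromWord (p ∷ w) w∈ = cong₂ _∷_ (toQ-coord (w∈ zero)) (toWord-fromWord w (w∈ ∘ suc))

-- Squares and forbidden subgraphs

corner : (x y d : Vec F2 n) → F2 → F2 → Pair n
corner x y d a b = x ⊕[ a ] d , y ⊕[ b ] d

SquareIn : List (Pair n) → (x y d : Vec F2 n) → Set
SquareIn A x y d = ∀ a b → corner x y d a b ∈ A

SquareIn-rebase : ∀ {A : List (Pair n)} {x y d} → SquareIn A x y d →
                  ∀ c c′ → SquareIn A (x ⊕[ c ] d) (y ⊕[ c′ ] d) d
SquareIn-rebase {A = A} {x} {y} {d} sq c c′ a b =
  subst₂ (λ s t → (s , t) ∈ A) (sym (⊕[]-⊕[] x d c a)) (sym (⊕[]-⊕[] y d c′ b))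
         (sq (c xor a) (c′ xor b))

line-corner : ∀ j (x y d : Vec F2 n) {a b a′ b′} → coord j (toQ a b) ≡ coord j (toQ a′ b′) →
              line j (corner x y d a b) ≡ line j (corner x y d a′ b′)
line-corner zero             x y d eq = cong (x ⊕[_] d) eq
line-corner (suc zero)       x y d eq = cong (y ⊕[_] d) eq
line-corner (suc (suc zero)) x y d {a} {b} {a′} {b′} eq = begin
  (x ⊕[ a ] d) ⊕ (y ⊕[ b ] d)   ≡⟨ ⊕[]-interchange x y d a b ⟩
  (x ⊕ y) ⊕[ a xor b ] d        ≡⟨ cong ((x ⊕ y) ⊕[_] d) eq ⟩
  (x ⊕ y) ⊕[ a′ xor b′ ] d      ≡⟨ ⊕[]-interchange x y d a′ b′ ⟨
  (x ⊕[ a′ ] d) ⊕ (y ⊕[ b′ ] d) ∎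
  where open ≡-Reasoning

normalise-square : ∀ {A : List (Pair n)} → ContainsSquare n A →
                   ∃[ i ] ∃[ x ] ∃[ y ] ∃[ d ]
                     lookup x i ≡ false × lookup y i ≡ false × lookup d i ≡ true × SquareIn A x y d
normalise-square {A = A} (x , y , d , d≢0 , m₀₀ , m₁₀ , m₀₁ , m₁₁) with ≢0v⇒∃true d d≢0
... | i , dᵢ≡1 =
  i , x ⊕[ lookup x i ] d , y ⊕[ lookup y i ] d , d , base-at x , base-at y , dᵢ≡1 ,
  SquareIn-rebase sq (lookup x i) (lookup y i)
  where
  base-at : ∀ z → lookup (z ⊕[ lookup z i ] d) i ≡ false
  base-at z = trans (lookup-⊕[] z d (lookup z i) dᵢ≡1) (xor-same (lookup z i))
  sq : SquareIn A x y d
  sq false false = m₀₀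
  sq true  false = m₁₀
  sq false true  = m₀₁
  sq true  true  = m₁₁

-- The r-th vertex of the subgraph is the corner whose i-th entries are those of the r-th
-- point of Q₀.
square⇒forbidden : ∀ {A : List (Pair n)} {x y d i} →
                   lookup x i ≡ false → lookup y i ≡ false → lookup d i ≡ true → SquareIn A x y d →
                   ContainsForbidden Q₀ n (map toWord A)
square⇒forbidden {n} {A} {x} {y} {d} {i} xᵢ≡0 yᵢ≡0 dᵢ≡1 sq = e , i , e∈ , covers , lines
  where
  a b : Fin 4 → F2
  a r = coord zero (List.lookup Q₀ r)
  b r = coord (suc zero) (List.lookup Q₀ r)

  e : Fin 4 → Vec Pt n
  e r = toWord (corner x y d (a r) (b r))

  e∈ : ∀ r → e r ∈ map toWord A
  e∈ r = ∈-map⁺ toWord (sq (a r) (b r))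

  ⊕[]-at : ∀ z → lookup z i ≡ false → ∀ c → lookup (z ⊕[ c ] d) i ≡ c
  ⊕[]-at z zᵢ≡0 c = trans (lookup-⊕[] z d c dᵢ≡1) (cong (_xor c) zᵢ≡0)

  e-at : ∀ r → lookup (e r) i ≡ toQ (a r) (b r)
  e-at r = trans (lookup-toWord (x ⊕[ a r ] d) (y ⊕[ b r ] d) i)
                 (cong₂ toQ (⊕[]-at x xᵢ≡0 (a r)) (⊕[]-at y yᵢ≡0 (b r)))

  covers : ∀ p → p ∈ Q₀ ⇔ (∃[ r ] lookup (e r) i ≡ p)
  covers p = mk⇔ hit (λ { (r , eᵣ≡p) → subst (_∈ Q₀) (trans (sym (e-at r)) eᵣ≡p) (toQ∈Q₀ (a r) (b r)) })
    where
    hit : p ∈ Q₀ → ∃[ r ] lookup (e r) i ≡ p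
    hit p∈Q₀ = r , trans (e-at r) (trans (toQ-coord (∈-lookup r)) (sym (lookup-index p∈Q₀)))
      where r = index p∈Q₀

  lines : ∀ j r r′ → coord j (lookup (e r) i) ≡ coord j (lookup (e r′) i) →
          col j (e r) ≡ col j (e r′)
  lines j r r′ eq = begin
    col j (e r)                         ≡⟨ col-toWord j _ _ ⟩
    line j (corner x y d (a r) (b r))   ≡⟨ line-corner j x y d eq′ ⟩
    line j (corner x y d (a r′) (b r′)) ≡⟨ col-toWord j _ _ ⟨
    col j (e r′)                        ∎
    where
    open ≡-Reasoning
    eq′ : coord j (toQ (a r) (b r)) ≡ coord j (toQ (a r′) (b r′))
    eq′ = trans (cong (coord j) (sym (e-at r))) (trans eq (cong (coord j) (e-at r′)))

rectangle⇒square : ∀ {A : List (Pair n)} {p₀₀ p₀₁ p₁₀ p₁₁ : Pair n} →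
                   proj₁ p₀₀ ≡ proj₁ p₀₁ → proj₁ p₁₀ ≡ proj₁ p₁₁ →
                   proj₂ p₀₀ ≡ proj₂ p₁₀ → proj₂ p₀₁ ≡ proj₂ p₁₁ →
                   line (suc (suc zero)) p₀₁ ≡ line (suc (suc zero)) p₁₀ → proj₁ p₀₀ ≢ proj₁ p₁₀ →
                   p₀₀ ∈ A → p₀₁ ∈ A → p₁₀ ∈ A → p₁₁ ∈ A → ContainsSquare n A
rectangle⇒square {A = A} {x , y} {_ , u} {x′ , _} {_ , _}
                 refl refl refl refl x⊕u≡x′⊕y x≢x′ m₀₀ m₀₁ m₁₀ m₁₁ =
  x , y , x ⊕ x′ , x≢x′ ∘ ⊕≡0v⇒≡ x x′ ,
  m₀₀ , at x⊕d≡x′ refl m₁₀ , at refl y⊕d≡u m₀₁ , at x⊕d≡x′ y⊕d≡u m₁₁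
  where
  x⊕d≡x′ = ⊕-cancelˡ x x′
  y⊕d≡u  = ⊕-swap x⊕u≡x′⊕y
  at : ∀ {s s′ t t′} → s ≡ s′ → t ≡ t′ → (s′ , t′) ∈ A → (s , t) ∈ A
  at s≡s′ t≡t′ = subst₂ (λ s t → (s , t) ∈ A) (sym s≡s′) (sym t≡t′)

forbidden⇒vertices : ∀ {A : List (Pair n)} → ContainsForbidden Q₀ n (map toWord A) →
  ∃[ i ] ∃[ vertex ]
    (∀ a b → vertex a b ∈ A) ×
    (∀ a b → lookup (toWord (vertex a b)) i ≡ toQ a b) ×
    (∀ j a b a′ b′ → coord j (toQ a b) ≡ coord j (toQ a′ b′) →
                     line j (vertex a b) ≡ line j (vertex a′ b′))
forbidden⇒vertices {n} {A} (e , i , e∈ , covers , lines) = i , vertex , vertex∈ , vertex-at , same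
  where
  pick : F2 → F2 → Fin 4
  pick a b = proj₁ (Equivalence.to (covers (toQ a b)) (toQ∈Q₀ a b))

  e-at : ∀ a b → lookup (e (pick a b)) i ≡ toQ a b
  e-at a b = proj₂ (Equivalence.to (covers (toQ a b)) (toQ∈Q₀ a b))

  vertex : F2 → F2 → Pair n
  vertex a b = proj₁ (∈-map⁻ toWord (e∈ (pick a b)))

  vertex∈ : ∀ a b → vertex a b ∈ A
  vertex∈ a b = proj₁ (proj₂ (∈-map⁻ toWord (e∈ (pick a b))))

  e≡vertex : ∀ a b → e (pick a b) ≡ toWord (vertex a b)
  e≡vertex a b = proj₂ (proj₂ (∈-map⁻ toWord (e∈ (pick a b))))

  vertex-at : ∀ a b → lookup (toWord (vertex a b)) i ≡ toQ a b
  vertex-at a b = trans (cong (λ w → lookup w i) (sym (e≡vertex a b))) (e-at a b)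

  same : ∀ j a b a′ b′ → coord j (toQ a b) ≡ coord j (toQ a′ b′) →
         line j (vertex a b) ≡ line j (vertex a′ b′)
  same j a b a′ b′ eq = begin
    line j (vertex a b)           ≡⟨ col-toWord j _ _ ⟨
    col j (toWord (vertex a b))   ≡⟨ cong (col j) (e≡vertex a b) ⟨
    col j (e (pick a b))          ≡⟨ lines j _ _ eq′ ⟩
    col j (e (pick a′ b′))        ≡⟨ cong (col j) (e≡vertex a′ b′) ⟩
    col j (toWord (vertex a′ b′)) ≡⟨ col-toWord j _ _ ⟩
    line j (vertex a′ b′)         ∎
    where
    open ≡-Reasoning
    eq′ : coord j (lookup (e (pick a b)) i) ≡ coord j (lookup (e (pick a′ b′)) i)
    eq′ = trans (cong (coord j) (e-at a b)) (trans eq (sym (cong (coord j) (e-at a′ b′))))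

forbidden⇒square : ∀ {A : List (Pair n)} → ContainsForbidden Q₀ n (map toWord A) → ContainsSquare n A
forbidden⇒square forbidden with forbidden⇒vertices forbidden
... | i , vertex , vertex∈ , vertex-at , same =
  rectangle⇒square
    (same zero false false false true refl) (same zero true false true true refl)
    (same (suc zero) false false true false refl) (same (suc zero) false true true true refl)
    (same (suc (suc zero)) false true true false refl) x₀₀≢x₁₀
    (vertex∈ false false) (vertex∈ false true) (vertex∈ true false) (vertex∈ true true)
  where
  vertex-x : ∀ a b → lookup (proj₁ (vertex a b)) i ≡ a
  vertex-x a b = cong (coord zero) (trans (sym (lookup-toWord x y i)) (vertex-at a b))
    where
    x = proj₁ (vertex a b)
    y = proj₂ (vertex a b)

  x₀₀≢x₁₀ : proj₁ (vertex false false) ≢ proj₁ (vertex true false)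
  x₀₀≢x₁₀ eq with trans (sym (vertex-x false false)) (trans (cong (λ z → lookup z i) eq) (vertex-x true false))
  ... | ()

forbidden⇔square : ∀ {A : List (Pair n)} → ContainsForbidden Q₀ n (map toWord A) ⇔ ContainsSquare n A
forbidden⇔square = mk⇔ forbidden⇒square λ sq →
  let (_ , _ , _ , _ , xᵢ≡0 , yᵢ≡0 , dᵢ≡1 , sq′) = normalise-square sq
  in  square⇒forbidden xᵢ≡0 yᵢ≡0 dᵢ≡1 sq′

ContainsSquare-mono : ∀ {A B : List (Pair n)} → A ⊆ B → ContainsSquare n A → ContainsSquare n B
ContainsSquare-mono A⊆B (x , y , d , d≢0 , m₀₀ , m₁₀ , m₀₁ , m₁₁) =
  x , y , d , d≢0 , A⊆B m₀₀ , A⊆B m₁₀ , A⊆B m₀₁ , A⊆B m₁₁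

_≟ₚ_ : DecidableEquality (Pair n)
_≟ₚ_ = Product.≡-dec (Vec.≡-dec Bool._≟_) (Vec.≡-dec Bool._≟_)

-- anySubset? quantifies over Subset n, which is Vec Bool n = 𝔽₂ⁿ.
containsSquare? : ∀ n (A : List (Pair n)) → Dec (ContainsSquare n A)
containsSquare? n A = anySubset? λ x → anySubset? λ y → anySubset? λ d →
  ¬? (Vec.≡-dec Bool._≟_ d 0v) ×-dec
  (x , y) ∈? A ×-dec (x ⊕ d , y) ∈? A ×-dec (x , y ⊕ d) ∈? A ×-dec (x ⊕ d , y ⊕ d) ∈? A
  where open DecMembership _≟ₚ_ using (_∈?_)

largest-squareFree : ∀ n → ∃[ M ] ((Unique M × ¬ ContainsSquare n M) ×
                                   (∀ A → Unique A × ¬ ContainsSquare n A → length A ≤ length M))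
largest-squareFree n =
  largest _≟ₚ_ (Unique.cartesianProduct⁺ (vectors-unique n) (vectors-unique n))
          (λ (x , y) → ∈-cartesianProduct⁺ (∈-vectors x) (∈-vectors y))
          (¬? ∘ containsSquare? n) (λ { (_ , _ , _ , _ , () , _) })
          (λ A⊆B ¬sqB → ¬sqB ∘ ContainsSquare-mono A⊆B)

toWords-forbiddenFree : ∀ {A : List (Pair n)} → Unique A × ¬ ContainsSquare n A →
                        IsSubsetOfQn Q₀ n (map toWord A) × ¬ ContainsForbidden Q₀ n (map toWord A)
toWords-forbiddenFree {A = A} (A! , ¬sq) =
  (Unique.map⁺ toWord-injective A! , All-map⁺ (All.universal toWord-isQWord A)) ,
  ¬sq ∘ Equivalence.to forbidden⇔square

toWords-fromWords : ∀ {W : List (Vec Pt n)} → All IsQWord W → map toWord (map fromWord W) ≡ W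
toWords-fromWords {W = W} W⊆Qⁿ =
  trans (sym (map-∘ W)) (map-id-local (All.map (toWord-fromWord _) W⊆Qⁿ))

fromWords-squareFree : ∀ {W : List (Vec Pt n)} → IsSubsetOfQn Q₀ n W × ¬ ContainsForbidden Q₀ n W →
                       Unique (map fromWord W) × ¬ ContainsSquare n (map fromWord W)
fromWords-squareFree {n} ((W! , W⊆Qⁿ) , ¬forb) =
  Unique.map⁻ (subst Unique (sym W≡) W!) ,
  ¬forb ∘ subst (ContainsForbidden Q₀ n) W≡ ∘ Equivalence.from forbidden⇔square
  where W≡ = toWords-fromWords W⊆Qⁿ

proposition4p7 : ∀ (n : ℕ) → ∃[ v ] (IsE Q₀ n v × IsRSquare n v)
proposition4p7 n with largest-squareFree n
... | M , M-squareFree , M-largest =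
  (+ length M) ℚ./ (4 ^ n) ,
  IsMaxOf-transfer (map toWord) (λ {A} A-ok → toWords-forbiddenFree A-ok , scaled-length toWord A)
                   (map fromWord) (λ {W} W-ok → fromWords-squareFree W-ok , scaled-length fromWord W) r□ ,
  r□
  where
  instance
    4ⁿ≢0 : NonZero (4 ^ n)
    4ⁿ≢0 = m^n≢0 4 n

  scaled-length : ∀ {X Y : Set} (f : X → Y) xs →
                  (+ length (map f xs)) ℚ./ (4 ^ n) ≡ (+ length xs) ℚ./ (4 ^ n)
  scaled-length f xs = cong (λ k → (+ k) ℚ./ (4 ^ n)) (length-map f xs)

  r□ : IsRSquare n ((+ length M) ℚ./ (4 ^ n))
  r□ = largest⇒IsMaxOf length (4 ^ n) M-squareFree M-largest
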